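{- Let $G=(V,E)$ be a graph with node weights $w:V\to\mathbb{N}$ and let $\vec x\in\{0,1\}^V$ be integral node values. Define $\mathbf{u}(\vec x)=\sum_{v\in V}w(v)x_v$ and $\mathbf{c}(\vec x)=\sum_{\{u,v\}\in E}\min\{w(u),w(v)\}x_ux_v$. Then there is a deterministic $1$-round $\mathsf{CONGEST}$ algorithm that computes an independent set $I$ of $G$ with $w(I)\ge\mathbf{u}(\vec x)-\mathbf{c}(\vec x)$.
   Context: $\mathsf{CONGEST}$: network $G$ with $n$ nodes and unique $O(\log n)$-bit IDs; each synchronous round, each node sends an $O(\log n)$-bit message to each neighbor. Each node $v$ knows $x_v$, and nodes know the weights of their neighbors (equivalently, weights can be communicated in a single round). $w(I)=\sum_{v\in I}w(v)$. -}

module Defs where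

open import Data.Nat using (ℕ; _+_; _*_; _⊓_; _<_; _≤_; _^_; suc)
open import Data.Bool using (Bool; true; false; T; _∧_; if_then_else_)
open import Data.Fin using (Fin; toℕ)
open import Data.List using (List; map; allFin; filterᵇ)
open import Data.Nat.ListAction using (sum)
open import Data.Product using (_×_; _,_)
open import Data.Empty using (⊥)
open import Relation.Binary.PropositionalEquality using (_≡_)

record Graph (n : ℕ) : Set where
  field
    adj   : Fin n → Fin n → Bool
    sym   : ∀ u v → adj u v ≡ adj v u
    irrefl : ∀ v → adj v v ≡ false
open Graph public

ΣV : ∀ {n} → (Fin n → ℕ) → ℕ
ΣV {n} f = sum (map f (allFin n))

nbrs : ∀ {n} → Graph n → Fin n → List (Fin n)
nbrs {n} G v = filterᵇ (adj G v) (allFin n)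

bit : Bool → ℕ
bit b = if b then 1 else 0

uval : ∀ {n} → (Fin n → ℕ) → (Fin n → Bool) → ℕ
uval w x = ΣV (λ v → w v * bit (x v))

-- c(x) = Σ_{{u,v} ∈ E} min(w u, w v) x_u x_v ; each edge counted once (u < v)
cval : ∀ {n} → Graph n → (Fin n → ℕ) → (Fin n → Bool) → ℕ
cval G w x = ΣV (λ u → ΣV (λ v →
  if (adj G u v ∧ (toℕ u Data.Nat.<ᵇ toℕ v))
  then (w u ⊓ w v) * bit (x u ∧ x v) else 0))

wset : ∀ {n} → (Fin n → ℕ) → (Fin n → Bool) → ℕ
wset w I = ΣV (λ v → w v * bit (I v))

Independent : ∀ {n} → Graph n → (Fin n → Bool) → Set
Independent G I = ∀ u v → T (adj G u v) → T (I u) → T (I v) → ⊥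

-- Deterministic 1-round CONGEST algorithms.
-- Before the round, a node knows: n, its own ID, its own weight, its own
-- value x_v, and the (ID, weight) pairs of its neighbours.
record View : Set where
  constructor mkView
  field
    size     : ℕ
    myId     : ℕ
    myWeight : ℕ
    myValue  : Bool
    nbrInfo  : List (ℕ × ℕ)
open View public

-- An algorithm: a message function (own view, recipient ID ↦ message,
-- a natural number encoding an O(log n)-bit string) and an output
-- function (own view, received (sender ID, message) pairs ↦ in I?).
record OneRoundAlg : Set where
  field
    send   : View → ℕ → ℕ
    output : View → List (ℕ × ℕ) → Bool
open OneRoundAlg public

module Run {n : ℕ} (G : Graph n) (ids : Fin n → ℕ) (w : Fin n → ℕ)
           (x : Fin n → Bool) (A : OneRoundAlg) where
  view : Fin n → View
  view v = mkView n (ids v) (w v) (x v) (map (λ u → ids u , w u) (nbrs G v))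

  msg : Fin n → Fin n → ℕ
  msg u v = send A (view u) (ids v)

  inbox : Fin n → List (ℕ × ℕ)
  inbox v = map (λ u → ids u , msg u v) (nbrs G v)

  result : Fin n → Bool
  result v = output A (view v) (inbox v)

-- IDs: unique and representable with O(log n) bits, i.e. < (n+1)^c
ValidIds : (c n : ℕ) → (Fin n → ℕ) → Set
ValidIds c n ids = (∀ u v → ids u ≡ ids v → u ≡ v) × (∀ v → ids v < suc n ^ c)

{-# OPTIONS --safe #-}
-- Every active node (x_v = 1) tells its neighbours that it is active, and joins I unless
-- some active neighbour outranks it in the lexicographic order on (weight, ID). Two adjacent
-- members of I would outrank each other, so I is independent. An active node v left out of I
-- has an active neighbour t outranking it, so w(v) = min(w(v), w(t)) is the contribution of the
-- edge vt to c(x); orienting every edge towards its higher-ranked endpoint charges each edge at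
-- most once, hence u(x) - w(I) ≤ c(x).
module Submission where

open import Defs hiding (sym)
open import Data.Nat using (ℕ; zero; suc; _+_; _*_; _⊓_; _<_; _≤_; _^_; z≤n; s≤s; _<ᵇ_; _≡ᵇ_)
open import Data.Nat.Properties
open import Data.Nat.ListAction using (sum)
open import Data.Bool using (Bool; true; false; T; T?; _∧_; _∨_; not; if_then_else_)
open import Data.Bool.Properties using (∧-comm; T-≡; T-∧; T-not-≡)
open import Data.Fin using (Fin; toℕ)
open import Data.Fin.Properties using (toℕ-injective) renaming (_≟_ to _≟ᶠ_)
open import Data.List using (List; []; _∷_; map; allFin; zip)
open import Data.Bool.ListAction using (any; or)
open import Data.List.Properties using (map-cong; map-∘)
open import Data.List.Membership.Propositional using (_∈_; find; lose)
open import Data.List.Membership.Propositional.Properties using (∈-allFin; ∈-filter⁺; ∈-filter⁻)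
open import Data.List.Relation.Unary.Any using (here; there)
open import Data.List.Relation.Unary.Any.Properties using (any⁺; any⁻)
open import Data.Product using (Σ; ∃; _×_; _,_; proj₁; proj₂)
open import Data.Sum using (_⊎_; inj₁; inj₂; [_,_]; map₂)
open import Function.Bundles using (module Equivalence)
open import Relation.Nullary using (¬_; yes; no; contradiction)
open import Relation.Nullary.Decidable using (toSum)
open import Relation.Binary using (tri<; tri≈; tri>)
open import Relation.Binary.PropositionalEquality using (_≡_; _≢_; refl; sym; trans; cong; subst; module ≡-Reasoning)
open import Algebra.Properties.CommutativeSemigroup +-commutativeSemigroup using (interchange)
open import Function using (_∘_)

sum-map-+ : {A : Set} (f g : A → ℕ) (l : List A) →
  sum (map (λ a → f a + g a) l) ≡ sum (map f l) + sum (map g l)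
sum-map-+ f g [] = refl
sum-map-+ f g (a ∷ l) =
  trans (cong (f a + g a +_) (sum-map-+ f g l)) (interchange (f a) (g a) _ _)

sum-map-cong : {A : Set} {f g : A → ℕ} (l : List A) → (∀ a → f a ≡ g a) →
  sum (map f l) ≡ sum (map g l)
sum-map-cong l f≗g = cong sum (map-cong f≗g l)

sum-map-mono : {A : Set} {f g : A → ℕ} (l : List A) → (∀ a → f a ≤ g a) →
  sum (map f l) ≤ sum (map g l)
sum-map-mono []      f≤g = z≤n
sum-map-mono (a ∷ l) f≤g = +-mono-≤ (f≤g a) (sum-map-mono l f≤g)

sum-map-zero : {A : Set} (l : List A) → sum (map (λ _ → 0) l) ≡ 0
sum-map-zero []      = refl
sum-map-zero (a ∷ l) = sum-map-zero l

sum-map-swap : {A B : Set} (f : A → B → ℕ) (k : List A) (l : List B) →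
  sum (map (λ a → sum (map (f a) l)) k) ≡ sum (map (λ b → sum (map (λ a → f a b) k)) l)
sum-map-swap f []      l = sym (sum-map-zero l)
sum-map-swap f (a ∷ k) l =
  trans (cong (sum (map (f a) l) +_) (sum-map-swap f k l))
        (sym (sum-map-+ (f a) (λ b → sum (map (λ a → f a b) k)) l))

∈⇒≤sum-map : {A : Set} (f : A → ℕ) {a : A} {l : List A} → a ∈ l → f a ≤ sum (map f l)
∈⇒≤sum-map f (here refl)          = m≤m+n _ _
∈⇒≤sum-map f {l = b ∷ l} (there a∈l) = ≤-trans (∈⇒≤sum-map f a∈l) (m≤n+m _ (f b))

m+m≡n+n⇒m≡n : ∀ {m n} → m + m ≡ n + n → m ≡ n
m+m≡n+n⇒m≡n {m} {n} eq with <-cmp m n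
... | tri< m<n _ _ = contradiction eq (<⇒≢ (+-mono-< m<n m<n))
... | tri≈ _ m≡n _ = m≡n
... | tri> _ _ n<m = contradiction (sym eq) (<⇒≢ (+-mono-< n<m n<m))

zip-map-diagonal : {A B C : Set} (f : A → B) (g : A → C) (l : List A) →
  zip (map f l) (map g l) ≡ map (λ a → f a , g a) l
zip-map-diagonal f g []      = refl
zip-map-diagonal f g (a ∷ l) = cong (_ ∷_) (zip-map-diagonal f g l)

any-map : {A B : Set} (p : B → Bool) (h : A → B) (l : List A) → any p (map h l) ≡ any (p ∘ h) l
any-map p h l = cong or (sym (map-∘ l))

<ᵇ-flip : ∀ i j → i ≢ j → (i <ᵇ j) ≡ not (j <ᵇ i)
<ᵇ-flip zero    zero    i≢j = contradiction refl i≢j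
<ᵇ-flip zero    (suc j) i≢j = refl
<ᵇ-flip (suc i) zero    i≢j = refl
<ᵇ-flip (suc i) (suc j) i≢j = <ᵇ-flip i j (i≢j ∘ cong suc)

IsOrientation : ∀ {n} → (Fin n → Fin n → Bool) → Set
IsOrientation R = ∀ u v → u ≢ v → R u v ≡ not (R v u)

orientedSum : ∀ {n} → (Fin n → Fin n → ℕ) → (Fin n → Fin n → Bool) → ℕ
orientedSum f R = ΣV λ u → ΣV λ v → if R u v then f u v else 0

module _ {n : ℕ} {f : Fin n → Fin n → ℕ}
         (f-sym : ∀ u v → f u v ≡ f v u) (f-diag : ∀ v → f v v ≡ 0) where

  orientedSum-double : ∀ {R} → IsOrientation R →
    orientedSum f R + orientedSum f R ≡ ΣV λ u → ΣV (f u)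
  orientedSum-double {R} R-orient = begin
    orientedSum f R + orientedSum f R
      ≡⟨ cong (orientedSum f R +_) (sum-map-swap (λ u v → if R u v then f u v else 0) (allFin n) (allFin n)) ⟩
    orientedSum f R + (ΣV λ u → ΣV λ v → if R v u then f v u else 0)
      ≡⟨ sym (sum-map-+ _ _ (allFin n)) ⟩
    (ΣV λ u → ΣV (λ v → if R u v then f u v else 0) + ΣV (λ v → if R v u then f v u else 0))
      ≡⟨ sum-map-cong (allFin n) (λ u → sym (sum-map-+ _ _ (allFin n))) ⟩
    (ΣV λ u → ΣV λ v → (if R u v then f u v else 0) + (if R v u then f v u else 0))
      ≡⟨ sum-map-cong (allFin n) (λ u → sum-map-cong (allFin n) (both-directions u)) ⟩
    (ΣV λ u → ΣV (f u)) ∎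
    where
    open ≡-Reasoning
    both-directions : ∀ u v → (if R u v then f u v else 0) + (if R v u then f v u else 0) ≡ f u v
    both-directions u v with u ≟ᶠ v
    ... | yes refl rewrite f-diag u with R u u
    ...   | true  = refl
    ...   | false = refl
    both-directions u v | no u≢v rewrite R-orient u v u≢v | f-sym v u with R v u
    ...   | true  = refl
    ...   | false = +-identityʳ _

  orientedSum-independent : ∀ {R S} → IsOrientation R → IsOrientation S →
    orientedSum f R ≡ orientedSum f S
  orientedSum-independent R-orient S-orient =
    m+m≡n+n⇒m≡n (trans (orientedSum-double R-orient) (sym (orientedSum-double S-orient)))

_≺ᵇ_ : ℕ × ℕ → ℕ × ℕ → Bool
(a , i) ≺ᵇ (b , j) = (a <ᵇ b) ∨ ((a ≡ᵇ b) ∧ (i <ᵇ j))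

≺ᵇ-flip : ∀ p q → proj₂ p ≢ proj₂ q → (p ≺ᵇ q) ≡ not (q ≺ᵇ p)
≺ᵇ-flip (zero  , i) (zero  , j) i≢j = <ᵇ-flip i j i≢j
≺ᵇ-flip (zero  , i) (suc b , j) i≢j = refl
≺ᵇ-flip (suc a , i) (zero  , j) i≢j = refl
≺ᵇ-flip (suc a , i) (suc b , j) i≢j = ≺ᵇ-flip (a , i) (b , j) i≢j

≺ᵇ⇒≤ : ∀ p q → T (p ≺ᵇ q) → proj₁ p ≤ proj₁ q
≺ᵇ⇒≤ (zero  , i) q           _ = z≤n
≺ᵇ⇒≤ (suc a , i) (suc b , j) p = s≤s (≺ᵇ⇒≤ (a , i) (b , j) p)

≡not⇒T⊎T : ∀ {a} b → a ≡ not b → T a ⊎ T b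
≡not⇒T⊎T false refl = inj₁ _
≡not⇒T⊎T true  _    = inj₂ _

bit-≡ᵇ-1 : ∀ b → (bit b ≡ᵇ 1) ≡ b
bit-≡ᵇ-1 true  = refl
bit-≡ᵇ-1 false = refl

*-bit-≤ : ∀ a r {w s} → (T a → T r ⊎ w ≤ s) → w * bit a ≤ w * bit r + s
*-bit-≤ false r     {w} _ = ≤-trans (≤-reflexive (*-zeroʳ w)) z≤n
*-bit-≤ true  true      _ = m≤m+n _ _
*-bit-≤ true  false {w} {s} h with h _
... | inj₂ w≤s = begin
  w * 1     ≡⟨ *-identityʳ w ⟩
  w         ≤⟨ w≤s ⟩
  s         ≤⟨ m≤n+m s (w * 0) ⟩
  w * 0 + s ∎
  where open ≤-Reasoning

bit<suc : ∀ b {k} → bit b < suc (suc k)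
bit<suc true  = s≤s (s≤s z≤n)
bit<suc false = s≤s z≤n

-- Pairs each neighbour's (ID, weight) from the view with the (ID, message) it sent; both
-- lists enumerate the neighbours in the same order.
outranks-me : View → (ℕ × ℕ) × (ℕ × ℕ) → Bool
outranks-me V ((j , b) , (_ , m)) = (m ≡ᵇ 1) ∧ ((myWeight V , myId V) ≺ᵇ (b , j))

greedy : OneRoundAlg
greedy = record
  { send   = λ V _ → bit (myValue V)
  ; output = λ V inbox → myValue V ∧ not (any (outranks-me V) (zip (nbrInfo V) inbox))
  }

module Greedy {n} (G : Graph n) (ids : Fin n → ℕ) (w : Fin n → ℕ) (x : Fin n → Bool)
              (ids-injective : ∀ u v → ids u ≡ ids v → u ≡ v) where
  open Run G ids w x greedy
  open Equivalence using (to; from)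

  _≺_ : Fin n → Fin n → Bool
  u ≺ v = (w u , ids u) ≺ᵇ (w v , ids v)

  ≺-orientation : IsOrientation _≺_
  ≺-orientation u v u≢v = ≺ᵇ-flip (w u , ids u) (w v , ids v) (u≢v ∘ ids-injective u v)

  index-orientation : IsOrientation {n} (λ u v → toℕ u <ᵇ toℕ v)
  index-orientation u v u≢v = <ᵇ-flip (toℕ u) (toℕ v) (u≢v ∘ toℕ-injective)

  threat : Fin n → Fin n → Bool
  threat v t = x t ∧ (v ≺ t)

  ∈-nbrs⁺ : ∀ {v t} → T (adj G v t) → t ∈ nbrs G v
  ∈-nbrs⁺ {v} {t} vt = ∈-filter⁺ (T? ∘ adj G v) (∈-allFin t) vt

  ∈-nbrs⁻ : ∀ {v t} → t ∈ nbrs G v → T (adj G v t)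
  ∈-nbrs⁻ {v} t∈ = proj₂ (∈-filter⁻ (T? ∘ adj G v) {xs = allFin n} t∈)

  result-≡ : ∀ v → result v ≡ x v ∧ not (any (threat v) (nbrs G v))
  result-≡ v = cong (λ b → x v ∧ not b) (begin
    any (outranks-me (view v))
        (zip (map (λ t → ids t , w t) (nbrs G v)) (map (λ t → ids t , bit (x t)) (nbrs G v)))
      ≡⟨ cong (any (outranks-me (view v))) (zip-map-diagonal _ _ (nbrs G v)) ⟩
    any (outranks-me (view v)) (map (λ t → (ids t , w t) , (ids t , bit (x t))) (nbrs G v))
      ≡⟨ any-map _ _ (nbrs G v) ⟩
    or (map (λ t → (bit (x t) ≡ᵇ 1) ∧ (v ≺ t)) (nbrs G v))
      ≡⟨ cong or (map-cong (λ t → cong (_∧ (v ≺ t)) (bit-≡ᵇ-1 (x t))) (nbrs G v)) ⟩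
    any (threat v) (nbrs G v) ∎)
    where open ≡-Reasoning

  included⇒active : ∀ {v} → T (result v) → T (x v)
  included⇒active {v} r = proj₁ (to T-∧ (subst T (result-≡ v) r))

  included⇒unthreatened : ∀ {v t} → T (result v) → T (adj G v t) → ¬ T (threat v t)
  included⇒unthreatened {v} {t} r vt th =
    subst T (to T-not-≡ (proj₂ (to T-∧ (subst T (result-≡ v) r))))
          (any⁺ (threat v) (lose (∈-nbrs⁺ vt) th))

  excluded⇒threatened : ∀ {v} → T (x v) → ¬ T (result v) → ∃ λ t → T (adj G v t) × T (threat v t)
  excluded⇒threatened {v} xv ¬r with any (threat v) (nbrs G v) in e
  ... | true  = let t , t∈ , th = find (any⁻ (threat v) (nbrs G v) (from T-≡ e))
                in t , ∈-nbrs⁻ t∈ , th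
  ... | false = contradiction (subst T (sym (result-≡ v)) (from T-∧ (xv , from T-not-≡ e))) ¬r

  independent : Independent G result
  independent u v uv ru rv with u ≟ᶠ v
  ... | yes refl = subst T (irrefl G u) uv
  ... | no u≢v = [ unthreatened u v uv ru rv , unthreatened v u vu rv ru ]
                   (≡not⇒T⊎T (v ≺ u) (≺-orientation u v u≢v))
    where
    vu = subst T (Graph.sym G u v) uv
    unthreatened : ∀ a b → T (adj G a b) → T (result a) → T (result b) → ¬ T (a ≺ b)
    unthreatened a b ab ra rb a≺b =
      included⇒unthreatened ra ab (from T-∧ (included⇒active rb , a≺b))

  edgeCost : Fin n → Fin n → ℕ
  edgeCost u v = if adj G u v then (w u ⊓ w v) * bit (x u ∧ x v) else 0

  edgeCost-sym : ∀ u v → edgeCost u v ≡ edgeCost v u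
  edgeCost-sym u v rewrite Graph.sym G u v | ⊓-comm (w u) (w v) | ∧-comm (x u) (x v) = refl

  edgeCost-diag : ∀ v → edgeCost v v ≡ 0
  edgeCost-diag v rewrite irrefl G v = refl

  cval-≡-orientedSum : cval G w x ≡ orientedSum edgeCost (λ u v → toℕ u <ᵇ toℕ v)
  cval-≡-orientedSum = sum-map-cong (allFin n) λ u → sum-map-cong (allFin n) λ v →
    if-∧ (adj G u v) (toℕ u <ᵇ toℕ v)
    where
    if-∧ : ∀ a b {h} → (if a ∧ b then h else 0) ≡ (if b then (if a then h else 0) else 0)
    if-∧ true  b     = refl
    if-∧ false true  = refl
    if-∧ false false = refl

  charged-edge : ∀ {v t} → T (x v) → T (adj G v t) → T (threat v t) →
    (if v ≺ t then edgeCost v t else 0) ≡ w v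
  charged-edge {v} {t} xv vt th = begin
    (if v ≺ t then edgeCost v t else 0)   ≡⟨ cong (if_then edgeCost v t else 0) (to T-≡ v≺t) ⟩
    edgeCost v t                          ≡⟨ cong (if_then (w v ⊓ w t) * bit (x v ∧ x t) else 0) (to T-≡ vt) ⟩
    (w v ⊓ w t) * bit (x v ∧ x t)         ≡⟨ cong (λ b → (w v ⊓ w t) * bit b) (to T-≡ (from T-∧ (xv , xt))) ⟩
    (w v ⊓ w t) * 1                       ≡⟨ *-identityʳ _ ⟩
    w v ⊓ w t                             ≡⟨ m≤n⇒m⊓n≡m (≺ᵇ⇒≤ (w v , ids v) (w t , ids t) v≺t) ⟩
    w v                                   ∎
    where
    open ≡-Reasoning
    xt = proj₁ (to T-∧ th)
    v≺t = proj₂ (to T-∧ th)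

  charge : Fin n → ℕ
  charge v = ΣV λ t → if v ≺ t then edgeCost v t else 0

  excluded⇒weight≤charge : ∀ {v} → T (x v) → ¬ T (result v) → w v ≤ charge v
  excluded⇒weight≤charge {v} xv ¬rv =
    let t , vt , th = excluded⇒threatened xv ¬rv in
    subst (_≤ charge v) (charged-edge xv vt th)
          (∈⇒≤sum-map (λ s → if v ≺ s then edgeCost v s else 0) (∈-allFin t))

  vertex-charge : ∀ v → w v * bit (x v) ≤ w v * bit (result v) + charge v
  vertex-charge v = *-bit-≤ (x v) (result v) λ xv →
    map₂ (excluded⇒weight≤charge xv) (toSum (T? (result v)))

  weight-bound : uval w x ≤ wset w result + cval G w x
  weight-bound = begin
    uval w x
      ≤⟨ sum-map-mono (allFin n) vertex-charge ⟩
    ΣV (λ v → w v * bit (result v) + charge v)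
      ≡⟨ sum-map-+ _ _ (allFin n) ⟩
    wset w result + orientedSum edgeCost _≺_
      ≡⟨ cong (wset w result +_)
              (orientedSum-independent edgeCost-sym edgeCost-diag ≺-orientation index-orientation) ⟩
    wset w result + orientedSum edgeCost (λ u v → toℕ u <ᵇ toℕ v)
      ≡⟨ cong (wset w result +_) cval-≡-orientedSum ⟨
    wset w result + cval G w x ∎
    where open ≤-Reasoning

lemma4p1 : Σ OneRoundAlg λ A → ∀ (cid : ℕ) → Σ ℕ λ c →
    ∀ (n : ℕ) (G : Graph n) (ids : Fin n → ℕ) (w : Fin n → ℕ) (x : Fin n → Bool) →
      ValidIds cid n ids →
        ((∀ u v → T (adj G u v) → Run.msg G ids w x A u v < suc n ^ c)
        × Independent G (Run.result G ids w x A)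
        × uval w x ≤ wset w (Run.result G ids w x A) + cval G w x)
lemma4p1 = greedy , λ _ → 1 , λ n G ids w x (ids-injective , _) →
  message-bound G ids w x ,
  Greedy.independent G ids w x ids-injective ,
  Greedy.weight-bound G ids w x ids-injective
  where
  message-bound : ∀ {n} (G : Graph n) ids w x →
    ∀ u v → T (adj G u v) → Run.msg G ids w x greedy u v < suc n ^ 1
  message-bound {suc k} _ _ _ x u _ _ rewrite *-identityʳ (suc (suc k)) = bit<suc (x u)
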